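{- Let $\lambda\vdash n$ and let $T$ be a Richardson tableau of shape $\lambda$. Then the set partition $\Pi(\operatorname{evac}(T))$ is obtained from $\Pi(T)$ by replacing each entry $i$ in each block of $\Pi(T)$ by $n+1-i$.
   Context: Young diagrams are in English notation. A standard Young tableau (SYT) of shape $\lambda\vdash n$ is a bijective filling with $[n]$ increasing along rows and down columns. For an SYT $S$ of shape $\lambda$ with first-row entries $1=a_1<\cdots<a_{\lambda_1}$ and $a_{\lambda_1+1}:=n+1$, $\Pi(S)$ is the set partition of $[n]$ with blocks $\{a_i,\ldots,a_{i+1}-1\}$, $1\le i\le\lambda_1$. Evacuation: given an SYT with $n$ boxes, delete the entry in the top-left cell, decrement remaining entries by $1$, and perform a jeu-de-taquin slide into the empty cell (the empty cell repeatedly swaps with the smaller of its right and lower non-frozen neighbours until none exists), giving a tableau on $n-1$ boxes whose shape is $\lambda$ minus a corner cell $c$; place $n$ in $c$ and freeze it; repeat on the non-frozen part placing $n-1,n-2,\ldots$ until all boxes are frozen; the result is $\operatorname{evac}(T)$. $\operatorname{crop}(T)$ is the SYT obtained by deleting the first row of $T$ and standardizing. An SYT $T$ is a Richardson tableau if (1) for every entry $j$ in the second row, $j-1$ lies in the first row, and (2) $\operatorname{crop}(T)$ is Richardson (the empty tableau being Richardson). -}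

module Defs where

open import Data.Nat using (ℕ; zero; suc; _+_; _∸_; _<_; _≤_; _≤?_; _<ᵇ_; pred)
open import Data.Bool using (if_then_else_)
open import Data.Nat.ListAction using (sum)
open import Data.List using (List; []; _∷_; map; concat; length; upTo; downFrom; filter; zip; foldl)
open import Data.List.Membership.Propositional using (_∈_)
open import Data.List.Relation.Unary.All using (All)
open import Data.List.Relation.Unary.Linked using (Linked)
open import Data.List.Relation.Binary.Permutation.Propositional using (_↭_)
import Data.List.Relation.Binary.Permutation.Propositional as PermProp
import Data.List.Relation.Binary.Permutation.Setoid as PermSetoid
open import Data.Maybe using (Maybe; just; nothing)
open import Data.Product using (_×_; _,_)
open import Data.Unit using (⊤)
open import Data.Empty using (⊥)
open import Data.Nat.Properties using (≤-refl)
open import Function using (const)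

-- a tableau = list of rows (top row first), each row read left to right
Tableau : Set
Tableau = List (List ℕ)

IsPartition : List ℕ → Set
IsPartition λ′ = All (λ k → 0 < k) λ′ × Linked (λ a b → b ≤ a) λ′

size : List ℕ → ℕ
size = sum

shape : Tableau → List ℕ
shape = map length

ColsInc : List ℕ → List ℕ → Set
ColsInc _        []       = ⊤
ColsInc []       (_ ∷ _)  = ⊥
ColsInc (x ∷ xs) (y ∷ ys) = x < y × ColsInc xs ys

ColsIncAll : Tableau → Set
ColsIncAll []             = ⊤
ColsIncAll (r ∷ [])       = ⊤
ColsIncAll (r ∷ s ∷ rest) = ColsInc r s × ColsIncAll (s ∷ rest)

IsSYT : List ℕ → Tableau → Set
IsSYT λ′ T =
  IsPartition λ′ × shape T ≡′ λ′ × All (Linked _<_) T × ColsIncAll T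
  × (concat T ↭ map suc (upTo (size λ′)))
  where
  open import Relation.Binary.PropositionalEquality using () renaming (_≡_ to _≡′_)

standardize : Tableau → Tableau
standardize T = map (map (λ x → length (filter (_≤? x) (concat T)))) T

crop : Tableau → Tableau
crop []       = []
crop (_ ∷ rs) = standardize rs

SecondRowCond : Tableau → Set
SecondRowCond []            = ⊤
SecondRowCond (r ∷ [])      = ⊤
SecondRowCond (r ∷ s ∷ _)   = All (λ j → (j ∸ 1) ∈ r) s

data Richardson : Tableau → Set where
  rich-empty : Richardson []
  rich-step  : ∀ r rs → SecondRowCond (r ∷ rs) → Richardson (crop (r ∷ rs))
             → Richardson (r ∷ rs)

-- Evacuation (positions (row, column) are 0-indexed internally)

lookupℕ : List ℕ → ℕ → Maybe ℕ
lookupℕ []       _       = nothing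
lookupℕ (x ∷ xs) zero    = just x
lookupℕ (x ∷ xs) (suc i) = lookupℕ xs i

get : Tableau → ℕ → ℕ → Maybe ℕ
get []       _       _ = nothing
get (r ∷ rs) zero    c = lookupℕ r c
get (r ∷ rs) (suc i) c = get rs i c

setRow : List ℕ → ℕ → ℕ → List ℕ
setRow []       _       _ = []
setRow (x ∷ xs) zero    v = v ∷ xs
setRow (x ∷ xs) (suc i) v = x ∷ setRow xs i v

set : Tableau → ℕ → ℕ → ℕ → Tableau
set []       _       _ _ = []
set (r ∷ rs) zero    c v = setRow r c v ∷ rs
set (r ∷ rs) (suc i) c v = r ∷ set rs i c v

dropLast : List ℕ → List ℕ
dropLast []           = []
dropLast (x ∷ [])     = []
dropLast (x ∷ y ∷ xs) = x ∷ dropLast (y ∷ xs)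

removeCell : Tableau → ℕ → Tableau
removeCell []       _       = []
removeCell (r ∷ rs) zero    with dropLast r
... | []      = rs
... | (x ∷ xs) = (x ∷ xs) ∷ rs
removeCell (r ∷ rs) (suc i) = r ∷ removeCell rs i

-- jeu-de-taquin slide of the empty cell at (i , c) in the (non-frozen)
-- tableau; the content of the empty cell is ignored.  Returns the
-- resulting tableau (empty cell deleted) and the vacated corner.
-- The fuel argument bounds the number of moves.
slide : ℕ → Tableau → ℕ → ℕ → Tableau × (ℕ × ℕ)
slide zero    T i c = removeCell T i , (i , c)
slide (suc k) T i c with get T i (suc c) | get T (suc i) c
... | nothing | nothing = removeCell T i , (i , c)
... | just x  | nothing = slide k (set T i c x) i (suc c)
... | nothing | just y  = slide k (set T i c y) (suc i) c
... | just x  | just y  =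
  if x <ᵇ y then slide k (set T i c x) i (suc c)
            else slide k (set T i c y) (suc i) c

numBoxes : Tableau → ℕ
numBoxes T = sum (shape T)

-- one evacuation step: delete top-left entry, decrement, slide
evacStep : Tableau → Tableau × (ℕ × ℕ)
evacStep T = slide (numBoxes T) (map (map pred) T) 0 0

-- the successive corners c where n, n-1, ..., 1 get placed
evacCorners : ℕ → Tableau → List (ℕ × ℕ)
evacCorners zero    T = []
evacCorners (suc k) T with evacStep T
... | T′ , p = p ∷ evacCorners k T′

evac : Tableau → Tableau
evac T = foldl place (map (map (const 0)) T)
               (zip (map suc (downFrom (numBoxes T))) (evacCorners (numBoxes T) T))
  where
  place : Tableau → ℕ × (ℕ × ℕ) → Tableau
  place U (v , (i , c)) = set U i c v

interval : ℕ → ℕ → List ℕ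
interval a b = map (a +_) (upTo (b ∸ a))

-- blocks {a_i, ..., a_{i+1}-1} for a first row a_1 < ... < a_k, a_{k+1} = n+1
blocksFrom : ℕ → List ℕ → List (List ℕ)
blocksFrom n []           = []
blocksFrom n (a ∷ [])     = interval a (suc n) ∷ []
blocksFrom n (a ∷ b ∷ as) = interval a b ∷ blocksFrom n (b ∷ as)

firstRow : Tableau → List ℕ
firstRow []      = []
firstRow (r ∷ _) = r

Π : Tableau → List (List ℕ)
Π S = blocksFrom (numBoxes S) (firstRow S)

-- Equality of set partitions: the lists of blocks agree up to reordering
-- the blocks and reordering the elements within each block.

_≈ₛₚ_ : List (List ℕ) → List (List ℕ) → Set
P ≈ₛₚ Q = PermSetoid._↭_ (PermProp.↭-setoid {A = ℕ}) P Q

-- Let n be the number of boxes and 1 = a₁ < a₂ < ⋯ < a_k the first row of T. In a Richardson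
-- tableau the predecessor of each entry of a row's successor row, among the entries from that row
-- down, lies in the row. This order-theoretic form of condition (1) survives crop, decrementing
-- the entries, and every jeu-de-taquin slide from the top-left cell, and it forces the hole of such
-- a slide, once it moves right, to run to the end of its row. So each evacuation step either
-- shortens the first row by one cell, which receives the current largest value, or moves the hole
-- off the first row at once, leaving its length unchanged. Following the first row through the
-- steps shows that the first row of evac T is 1, n+2−a_k, …, n+2−a₂; hence the blocks
-- [n+2−a_{i+1}, n+2−a_i) of Π(evac T) are the images of the blocks [a_i, a_{i+1}) of Π(T) under
-- i ↦ n+1−i.

module Submission where

open import Defs
open import Data.Nat using (ℕ; zero; suc; _+_; _∸_; _<_; _≤_; _<ᵇ_; pred; z≤n; s≤s; z<s; _≤?_; _<?_)
open import Data.Nat.Properties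
open import Data.Bool using (true; false)
open import Data.Bool.Properties using (T-≡)
open import Data.List
  using (List; []; _∷_; _++_; [_]; drop; filter; map; concat; length; upTo; downFrom; zip; foldl; reverse; replicate)
open import Data.List.Properties
  using ( ++-identityʳ; ++-assoc; ∷ʳ-++; map-id; map-∘; map-cong; map-cong-local; map-++; concat-map; length-map
        ; map-applyUpTo; length-applyUpTo; applyUpTo-∷ʳ; unfold-reverse; reverse-++; reverse-map
        ; filter-accept; filter-reject)
open import Data.List.Membership.Propositional using (_∈_)
open import Data.List.Membership.Propositional.Properties using (∈-++⁺ˡ; ∈-++⁺ʳ; ∈-++⁻; ∈-map⁺; ∈-map⁻; ∈-upTo⁻)
open import Data.List.Relation.Binary.Subset.Propositional using (_⊆_)
open import Data.List.Relation.Unary.Any using (here; there)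
open import Data.List.Relation.Unary.All as All using (All; []; _∷_)
import Data.List.Relation.Unary.All.Properties as Allₚ
open import Data.List.Relation.Unary.Linked as Linked using (Linked; []; [-]; _∷_)
open import Data.List.Relation.Unary.Linked.Properties using (Linked⇒All)
open import Data.List.Relation.Unary.AllPairs as AllPairs using ([]; _∷_)
open import Data.List.Relation.Unary.Unique.Propositional using (Unique)
import Data.List.Relation.Unary.Unique.Propositional.Properties as Unique
open import Data.List.Relation.Binary.Permutation.Propositional
  using (_↭_; ↭-setoid; module PermutationReasoning; ↭-sym; ↭-trans; ↭-refl; prep; ↭⇒↭ₛ)
open import Data.List.Relation.Binary.Permutation.Propositional.Properties
  using (All-resp-↭; ∈-resp-↭; ++⁺ˡ; shift; drop-∷; ↭-length; map⁺; ∷↭∷ʳ; ↭-reverse)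
import Data.List.Relation.Binary.Permutation.Setoid as SetoidPermutation
import Data.List.Relation.Binary.Permutation.Setoid.Properties as SetoidPermutationProperties
open import Data.List.Relation.Binary.Pointwise as Pointwise using (Pointwise; []; _∷_)
open import Data.Product using (_×_; _,_; proj₁; proj₂; ∃-syntax)
open import Data.Sum using (inj₁; inj₂)
open import Data.Unit using (⊤; tt)
open import Data.Maybe using (just; nothing)
open import Function using (_∘_; id; case_of_; Equivalence)
open import Relation.Binary.PropositionalEquality hiding ([_])
open import Relation.Nullary using (¬_; yes; no; contradiction)
open import Relation.Binary.Definitions using (tri<; tri≈; tri>)

private
  module BlockPermutation = SetoidPermutation (↭-setoid {A = ℕ})
  module BlockPermutationProperties = SetoidPermutationProperties (↭-setoid {A = ℕ})

head<∈ : ∀ {x xs y} → Linked _<_ (x ∷ xs) → y ∈ xs → x < y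
head<∈ (x<x′ ∷ _) (here refl) = x<x′
head<∈ (x<x′ ∷ l) (there y∈)  = <-trans x<x′ (head<∈ l y∈)

head≤∈ : ∀ {x xs y} → Linked _<_ (x ∷ xs) → y ∈ x ∷ xs → x ≤ y
head≤∈ l (here refl) = ≤-refl
head≤∈ l (there y∈)  = <⇒≤ (head<∈ l y∈)

∈-tail : ∀ {x xs y} → y ∈ x ∷ xs → x < y → y ∈ xs
∈-tail (here refl) x<x = contradiction x<x (<-irrefl refl)
∈-tail (there y∈)  _   = y∈

MaxBelow : List ℕ → ℕ → ℕ → Set
MaxBelow L j p = p < j × (∀ {y} → y ∈ L → y < j → y ≤ p)

maxBelow-sorted : ∀ {x xs j} → Linked _<_ (x ∷ xs) → x < j →
                  ∃[ p ] p ∈ x ∷ xs × MaxBelow (x ∷ xs) j p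
maxBelow-sorted {x} {[]} _ x<j = x , here refl , x<j , λ { (here refl) _ → ≤-refl }
maxBelow-sorted {x} {x′ ∷ xs} {j} (x<x′ ∷ l) x<j with x′ <? j
... | yes x′<j =
  let p , p∈ , p<j , max = maxBelow-sorted l x′<j in
  p , there p∈ , p<j ,
  λ { (here refl) _ → <⇒≤ (<-≤-trans x<x′ (max (here refl) x′<j)) ; (there y∈) y<j → max y∈ y<j }
... | no x′≮j =
  x , here refl , x<j ,
  λ { (here refl) _ → ≤-refl ; (there y∈) y<j → contradiction (≤-<-trans (head≤∈ l y∈) y<j) x′≮j }

maxBelow-++ : ∀ {A B j p} → MaxBelow A j p → (∀ {y} → y ∈ B → j ≤ y) → MaxBelow (A ++ B) j p
maxBelow-++ {A} (p<j , max) B≥j = p<j , λ y∈ y<j → case ∈-++⁻ A y∈ of λ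
  { (inj₁ y∈A) → max y∈A y<j
  ; (inj₂ y∈B) → contradiction (B≥j y∈B) (<⇒≱ y<j) }

Unique-++ʳ : ∀ xs {ys : List ℕ} → Unique (xs ++ ys) → Unique ys
Unique-++ʳ []       u       = u
Unique-++ʳ (x ∷ xs) (_ ∷ u) = Unique-++ʳ xs u

Unique-resp-↭ : ∀ {xs ys : List ℕ} → xs ↭ ys → Unique xs → Unique ys
Unique-resp-↭ p = SetoidPermutationProperties.Unique-resp-↭ (setoid ℕ) (↭⇒↭ₛ p)

StrictlyMonotoneOn : List ℕ → (ℕ → ℕ) → Set
StrictlyMonotoneOn L f = ∀ {x y} → x ∈ L → y ∈ L → x < y → f x < f y

module StrictlyMonotoneOn {L : List ℕ} {f : ℕ → ℕ} (mono : StrictlyMonotoneOn L f) where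

  reflects-< : ∀ {x y} → x ∈ L → y ∈ L → f x < f y → x < y
  reflects-< {x} {y} x∈ y∈ fx<fy with <-cmp x y
  ... | tri< x<y _ _    = x<y
  ... | tri≈ _ refl _   = contradiction fx<fy (<-irrefl refl)
  ... | tri> _ _ y<x    = contradiction (mono y∈ x∈ y<x) (<-asym fx<fy)

  preserves-≤ : ∀ {x y} → x ∈ L → y ∈ L → x ≤ y → f x ≤ f y
  preserves-≤ x∈ y∈ x≤y = ≮⇒≥ (λ fy<fx → <⇒≱ (reflects-< y∈ x∈ fy<fx) x≤y)

  reflects-≤ : ∀ {x y} → x ∈ L → y ∈ L → f x ≤ f y → x ≤ y
  reflects-≤ x∈ y∈ fx≤fy = ≮⇒≥ (λ y<x → <⇒≱ (mono y∈ x∈ y<x) fx≤fy)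

  injective : ∀ {x y} → x ∈ L → y ∈ L → f x ≡ f y → x ≡ y
  injective x∈ y∈ fx≡fy =
    ≤-antisym (reflects-≤ x∈ y∈ (≤-reflexive fx≡fy)) (reflects-≤ y∈ x∈ (≤-reflexive (sym fx≡fy)))

  restrict : ∀ {L′} → L′ ⊆ L → StrictlyMonotoneOn L′ f
  restrict L′⊆L x∈ y∈ = mono (L′⊆L x∈) (L′⊆L y∈)

  linked : ∀ {r} → r ⊆ L → Linked _<_ r → Linked _<_ (map f r)
  linked r⊆ []          = []
  linked r⊆ [-]         = [-]
  linked r⊆ (x<y ∷ l)   = mono (r⊆ (here refl)) (r⊆ (there (here refl))) x<y ∷ linked (r⊆ ∘ there) l

  colsInc : ∀ {r s} → r ⊆ L → s ⊆ L → ColsInc r s → ColsInc (map f r) (map f s)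
  colsInc {r}     {[]}    r⊆ s⊆ c             = tt
  colsInc {x ∷ r} {y ∷ s} r⊆ s⊆ (x<y , c) =
    mono (r⊆ (here refl)) (s⊆ (here refl)) x<y , colsInc (r⊆ ∘ there) (s⊆ ∘ there) c

  unique : Unique L → Unique (map f L)
  unique = go id
    where
    go : ∀ {K} → K ⊆ L → Unique K → Unique (map f K)
    go K⊆ []          = []
    go K⊆ (x∉ ∷ u) =
      Allₚ.map⁺ (All.tabulate λ y∈ fx≡fy →
        All.lookup x∉ y∈ (injective (K⊆ (here refl)) (K⊆ (there y∈)) fx≡fy)) ∷ go (K⊆ ∘ there) u

NonEmptyRows : Tableau → Set
NonEmptyRows = All (λ r → 0 < length r)

mapEntries : (ℕ → ℕ) → Tableau → Tableau
mapEntries f = map (map f)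

colsIncAll-∷⁻ : ∀ r U → ColsIncAll (r ∷ U) → ColsInc r (firstRow U) × ColsIncAll U
colsIncAll-∷⁻ r []      _ = tt , tt
colsIncAll-∷⁻ r (s ∷ U) c = c

colsIncAll-∷⁺ : ∀ r U → ColsInc r (firstRow U) → ColsIncAll U → ColsIncAll (r ∷ U)
colsIncAll-∷⁺ r []      _ _ = tt
colsIncAll-∷⁺ r (s ∷ U) c d = c , d

colsInc-tail : ∀ xs ys → ColsInc xs ys → Linked _<_ ys → ColsInc xs (drop 1 ys)
colsInc-tail xs            []                 _ _ = tt
colsInc-tail xs            (y ∷ [])           _ _ = tt
colsInc-tail (x ∷ x′ ∷ xs) (y ∷ y′ ∷ ys) (x<y , x′<y′ , c) (y<y′ ∷ l) =
  <-trans x<y y<y′ , colsInc-tail (x′ ∷ xs) (y′ ∷ ys) (x′<y′ , c) l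

topLeft≤ : ∀ {e xs U y} → NonEmptyRows U → All (Linked _<_) ((e ∷ xs) ∷ U) → ColsIncAll ((e ∷ xs) ∷ U) →
           y ∈ concat ((e ∷ xs) ∷ U) → e ≤ y
topLeft≤ {e} {xs} ne (l ∷ ls) c y∈ with ∈-++⁻ (e ∷ xs) y∈
... | inj₁ y∈row = head≤∈ l y∈row
topLeft≤ {U = (h ∷ σ) ∷ U} (_ ∷ ne) (l ∷ ls) ((e<h , _) , c) _ | inj₂ y∈rest =
  ≤-trans (<⇒≤ e<h) (topLeft≤ ne ls c y∈rest)

-- Condition (1) of a Richardson tableau in a form invariant under order embeddings of the
-- entries: the predecessor, among the entries of a row and the rows below, of every entry
-- of the next row lies in the row.

PredsIn : List ℕ → List ℕ → List ℕ → Set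
PredsIn L r = All (λ j → ∃[ p ] p ∈ r × MaxBelow L j p)

PredRichardson : Tableau → Set
PredRichardson []          = ⊤
PredRichardson (r ∷ [])    = ⊤
PredRichardson (r ∷ s ∷ U) = PredsIn (concat (r ∷ s ∷ U)) r s × PredRichardson (s ∷ U)

predRichardson-tail : ∀ r U → PredRichardson (r ∷ U) → PredRichardson U
predRichardson-tail r []      _         = tt
predRichardson-tail r (s ∷ U) (_ , pss) = pss

predRichardson-∷⁺ : ∀ r U → PredsIn (concat (r ∷ U)) r (firstRow U) → PredRichardson U → PredRichardson (r ∷ U)
predRichardson-∷⁺ r []      _  _   = tt
predRichardson-∷⁺ r (s ∷ U) ps pss = ps , pss

record RichardsonFilling (T : Tableau) : Set where
  field
    rows-nonempty      : NonEmptyRows T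
    rows-increasing    : All (Linked _<_) T
    columns-increasing : ColsIncAll T
    predecessors       : PredRichardson T
    entries-unique     : Unique (concat T)

open RichardsonFilling

RichardsonFilling-topLeft≤ : ∀ {e xs U y} → RichardsonFilling ((e ∷ xs) ∷ U) → y ∈ concat ((e ∷ xs) ∷ U) → e ≤ y
RichardsonFilling-topLeft≤ rf = topLeft≤ (All.tail (rows-nonempty rf)) (rows-increasing rf) (columns-increasing rf)

module _ {f : ℕ → ℕ} where

  private module Mono {L} (mono : StrictlyMonotoneOn L f) = StrictlyMonotoneOn mono

  predsIn-map : ∀ {L r s} → StrictlyMonotoneOn L f → r ⊆ L → s ⊆ L →
                PredsIn L r s → PredsIn (map f L) (map f r) (map f s)
  predsIn-map {s = []}    mono r⊆ s⊆ []                         = []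
  predsIn-map {L} {s = j ∷ s} mono r⊆ s⊆ ((p , p∈ , p<j , max) ∷ ps) =
    (f p , ∈-map⁺ f p∈ , mono (r⊆ p∈) (s⊆ (here refl)) p<j , max′) ∷ predsIn-map mono r⊆ (s⊆ ∘ there) ps
    where
    max′ : ∀ {y′} → y′ ∈ map f L → y′ < f j → y′ ≤ f p
    max′ y′∈ y′<fj with ∈-map⁻ f y′∈
    ... | y , y∈ , refl = Mono.preserves-≤ mono y∈ (r⊆ p∈) (max y∈ (Mono.reflects-< mono y∈ (s⊆ (here refl)) y′<fj))

  predsIn-map⁻ : ∀ {L r s} → StrictlyMonotoneOn L f → r ⊆ L → s ⊆ L →
                 PredsIn (map f L) (map f r) (map f s) → PredsIn L r s
  predsIn-map⁻ {s = []}    mono r⊆ s⊆ _ = []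
  predsIn-map⁻ {s = j ∷ s} mono r⊆ s⊆ ((p′ , p′∈ , p′<fj , max) ∷ ps) with ∈-map⁻ f p′∈
  ... | p , p∈ , refl =
    (p , p∈ , Mono.reflects-< mono (r⊆ p∈) (s⊆ (here refl)) p′<fj ,
     λ y∈ y<j → Mono.reflects-≤ mono y∈ (r⊆ p∈) (max (∈-map⁺ f y∈) (mono y∈ (s⊆ (here refl)) y<j))) ∷
    predsIn-map⁻ mono r⊆ (s⊆ ∘ there) ps

  concat-mapEntries : ∀ T → concat (mapEntries f T) ≡ map f (concat T)
  concat-mapEntries = concat-map

  predRichardson-map : ∀ {T} → StrictlyMonotoneOn (concat T) f → PredRichardson T → PredRichardson (mapEntries f T)
  predRichardson-map {[]}        _    _          = tt
  predRichardson-map {r ∷ []}    _    _          = tt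
  predRichardson-map {r ∷ s ∷ U} mono (ps , pss) =
    subst (λ L → PredsIn L (map f r) (map f s)) (sym (concat-mapEntries (r ∷ s ∷ U)))
      (predsIn-map mono ∈-++⁺ˡ (∈-++⁺ʳ r ∘ ∈-++⁺ˡ) ps) ,
    predRichardson-map (Mono.restrict mono (∈-++⁺ʳ r)) pss

  predRichardson-map⁻ : ∀ {T} → StrictlyMonotoneOn (concat T) f → PredRichardson (mapEntries f T) → PredRichardson T
  predRichardson-map⁻ {[]}        _    _          = tt
  predRichardson-map⁻ {r ∷ []}    _    _          = tt
  predRichardson-map⁻ {r ∷ s ∷ U} mono (ps , pss) =
    predsIn-map⁻ mono ∈-++⁺ˡ (∈-++⁺ʳ r ∘ ∈-++⁺ˡ)
      (subst (λ L → PredsIn L (map f r) (map f s)) (concat-mapEntries (r ∷ s ∷ U)) ps) ,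
    predRichardson-map⁻ (Mono.restrict mono (∈-++⁺ʳ r)) pss

  colsIncAll-map : ∀ {T} → StrictlyMonotoneOn (concat T) f → ColsIncAll T → ColsIncAll (mapEntries f T)
  colsIncAll-map {[]}        _    _        = tt
  colsIncAll-map {r ∷ []}    _    _        = tt
  colsIncAll-map {r ∷ s ∷ U} mono (c , cs) =
    Mono.colsInc mono ∈-++⁺ˡ (∈-++⁺ʳ r ∘ ∈-++⁺ˡ) c , colsIncAll-map (Mono.restrict mono (∈-++⁺ʳ r)) cs

  rowsIncreasing-map : ∀ {T} → StrictlyMonotoneOn (concat T) f → All (Linked _<_) T → All (Linked _<_) (mapEntries f T)
  rowsIncreasing-map {[]}    _    []       = []
  rowsIncreasing-map {r ∷ U} mono (l ∷ ls) =
    Mono.linked mono ∈-++⁺ˡ l ∷ rowsIncreasing-map (Mono.restrict mono (∈-++⁺ʳ r)) ls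

  nonEmptyRows-map : ∀ {T} → NonEmptyRows T → NonEmptyRows (mapEntries f T)
  nonEmptyRows-map {[]}          []       = []
  nonEmptyRows-map {(x ∷ r) ∷ T} (_ ∷ ne) = z<s ∷ nonEmptyRows-map ne

  RichardsonFilling-map : ∀ {T} → StrictlyMonotoneOn (concat T) f → RichardsonFilling T → RichardsonFilling (mapEntries f T)
  RichardsonFilling-map {T} mono rf = record
    { rows-nonempty      = nonEmptyRows-map (rows-nonempty rf)
    ; rows-increasing    = rowsIncreasing-map mono (rows-increasing rf)
    ; columns-increasing = colsIncAll-map mono (columns-increasing rf)
    ; predecessors       = predRichardson-map mono (predecessors rf)
    ; entries-unique     = subst Unique (sym (concat-mapEntries T)) (Mono.unique mono (entries-unique rf))
    }

-- Jeu de taquin slides from the top-left cell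

underRow : List ℕ → Tableau × (ℕ × ℕ) → Tableau × (ℕ × ℕ)
underRow r (U , (i , c)) = r ∷ U , (suc i , c)

slide-underRow : ∀ k r U i c → slide k (r ∷ U) (suc i) c ≡ underRow r (slide k U i c)
slide-underRow zero    r U i c = refl
slide-underRow (suc k) r U i c with get U i (suc c) | get U (suc i) c
... | nothing | nothing = refl
... | just x  | nothing = slide-underRow k r (set U i c x) i (suc c)
... | nothing | just y  = slide-underRow k r (set U i c y) (suc i) c
... | just x  | just y  with x <ᵇ y
...   | true  = slide-underRow k r (set U i c x) i (suc c)
...   | false = slide-underRow k r (set U i c y) (suc i) c

consNonEmpty : List ℕ → Tableau → Tableau
consNonEmpty []       rs = rs
consNonEmpty (x ∷ xs) rs = (x ∷ xs) ∷ rs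

removeCell-top : ∀ r rs → removeCell (r ∷ rs) 0 ≡ consNonEmpty (dropLast r) rs
removeCell-top r rs with dropLast r
... | []     = refl
... | x ∷ xs = refl

dropLast-∷ʳ : ∀ P (e : ℕ) → dropLast (P ++ [ e ]) ≡ P
dropLast-∷ʳ []          e = refl
dropLast-∷ʳ (p ∷ [])    e = refl
dropLast-∷ʳ (p ∷ q ∷ P) e = cong (p ∷_) (dropLast-∷ʳ (q ∷ P) e)

lookup-past : ∀ P y ys → lookupℕ (P ++ y ∷ ys) (suc (length P)) ≡ lookupℕ ys 0
lookup-past []      y ys = refl
lookup-past (p ∷ P) y ys = lookup-past P y ys

setRow-++ : ∀ P e ys v → setRow (P ++ e ∷ ys) (length P) v ≡ P ++ v ∷ ys
setRow-++ []      e ys v = refl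
setRow-++ (p ∷ P) e ys v = cong (p ∷_) (setRow-++ P e ys v)

length-∷ʳ : ∀ P (x : ℕ) → length (P ++ [ x ]) ≡ suc (length P)
length-∷ʳ []      x = refl
length-∷ʳ (p ∷ P) x = cong suc (length-∷ʳ P x)

<ᵇ≡true : ∀ {m n} → m < n → (m <ᵇ n) ≡ true
<ᵇ≡true m<n = Equivalence.to T-≡ (<⇒<ᵇ m<n)

<ᵇ≡false : ∀ {m n} → n ≤ m → (m <ᵇ n) ≡ false
<ᵇ≡false {m} {n} n≤m with m <ᵇ n | <ᵇ⇒< m n
... | false | _   = refl
... | true  | m<n = contradiction (m<n tt) (≤⇒≯ n≤m)

-- The hole sits at column length P of the first row P ++ e ∷ xs (e is its stale content);
-- zs is the part of the second row from that column on.
slide-alongRow : ∀ P e xs zs rs k → length xs < k → ColsInc xs zs →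
                 (∀ j → get rs 0 (j + length P) ≡ lookupℕ zs j) →
                 slide k ((P ++ e ∷ xs) ∷ rs) 0 (length P) ≡ (consNonEmpty (P ++ xs) rs , (0 , length P + length xs))
slide-alongRow P e [] [] rs (suc k) _ _ below
  rewrite lookup-past P e [] | below 0 | removeCell-top (P ++ e ∷ []) rs | dropLast-∷ʳ P e
        | ++-identityʳ P | +-identityʳ (length P) = refl
slide-alongRow P e (x ∷ xs) zs rs (suc k) (s≤s |xs|<k) cols below = moveRight zs cols below
  where
  continue : ∀ zs′ → ColsInc xs zs′ → (∀ j → get rs 0 (suc j + length P) ≡ lookupℕ zs′ j) →
             slide k ((P ++ x ∷ x ∷ xs) ∷ rs) 0 (suc (length P)) ≡
             (consNonEmpty (P ++ x ∷ xs) rs , (0 , length P + suc (length xs)))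
  continue zs′ cols′ below′ =
    subst₂ (λ Q c → slide k (Q ∷ rs) 0 c ≡ (consNonEmpty (P ++ x ∷ xs) rs , (0 , length P + suc (length xs))))
      (∷ʳ-++ P x (x ∷ xs)) (length-∷ʳ P x)
      (trans (slide-alongRow (P ++ [ x ]) x xs zs′ rs k |xs|<k cols′ below″)
        (cong₂ (λ Q c → consNonEmpty Q rs , (0 , c)) (∷ʳ-++ P x xs)
          (trans (cong (_+ length xs) (length-∷ʳ P x)) (sym (+-suc (length P) (length xs))))))
    where
    below″ : ∀ j → get rs 0 (j + length (P ++ [ x ])) ≡ lookupℕ zs′ j
    below″ j = trans (cong (λ c → get rs 0 (j + c)) (length-∷ʳ P x))
                     (trans (cong (get rs 0) (+-suc j (length P))) (below′ j))
  moveRight : ∀ zs → ColsInc (x ∷ xs) zs → (∀ j → get rs 0 (j + length P) ≡ lookupℕ zs j) →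
              slide (suc k) ((P ++ e ∷ x ∷ xs) ∷ rs) 0 (length P) ≡
              (consNonEmpty (P ++ x ∷ xs) rs , (0 , length P + suc (length xs)))
  moveRight []        _            below
    rewrite lookup-past P e (x ∷ xs) | below 0 | setRow-++ P e (x ∷ xs) x = continue [] tt (below ∘ suc)
  moveRight (z ∷ zs′) (x<z , cols′) below
    rewrite lookup-past P e (x ∷ xs) | below 0 | <ᵇ≡true x<z | setRow-++ P e (x ∷ xs) x =
    continue zs′ cols′ (below ∘ suc)

get-firstRow : ∀ rs j → get rs 0 j ≡ lookupℕ (firstRow rs) j
get-firstRow []       j = refl
get-firstRow (r ∷ rs) j = refl

slide-along : ∀ {k e xs rs} → numBoxes ((e ∷ xs) ∷ rs) ≤ k → ColsInc xs (firstRow rs) →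
              slide k ((e ∷ xs) ∷ rs) 0 0 ≡ (consNonEmpty xs rs , (0 , length xs))
slide-along {k} {e} {xs} {rs} size≤k cols =
  slide-alongRow [] e xs (firstRow rs) rs k (≤-trans (s≤s (m≤m+n (length xs) (numBoxes rs))) size≤k) cols
    (λ j → trans (get-firstRow rs (j + 0)) (cong (lookupℕ (firstRow rs)) (+-identityʳ j)))

slide-down : ∀ k e xs h σ rs → (∀ {x xs′} → xs ≡ x ∷ xs′ → h ≤ x) →
             slide (suc k) ((e ∷ xs) ∷ (h ∷ σ) ∷ rs) 0 0 ≡ underRow (h ∷ xs) (slide k ((h ∷ σ) ∷ rs) 0 0)
slide-down k e []       h σ rs _   = slide-underRow k (h ∷ []) ((h ∷ σ) ∷ rs) 0 0
slide-down k e (x ∷ xs) h σ rs h≤x rewrite <ᵇ≡false (h≤x refl) = slide-underRow k (h ∷ x ∷ xs) ((h ∷ σ) ∷ rs) 0 0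

predsIn-mono : ∀ {L L′ r r′ s} → L′ ⊆ L → r ⊆ r′ → PredsIn L r s → PredsIn L′ r′ s
predsIn-mono L′⊆L r⊆r′ = All.map (λ (p , p∈ , p<j , max) → p , r⊆r′ p∈ , p<j , max ∘ L′⊆L)

predsIn-dropHead : ∀ {L e r s} → (∀ {j} → j ∈ s → ∃[ y ] y ∈ L × e < y × y < j) →
                   PredsIn L (e ∷ r) s → PredsIn L r s
predsIn-dropHead {s = []}    _       []                         = []
predsIn-dropHead {s = j ∷ s} between ((p , p∈ , p<j , max) ∷ ps) =
  let y , y∈ , e<y , y<j = between (here refl) in
  (p , ∈-tail p∈ (<-≤-trans e<y (max y∈ y<j)) , p<j , max) ∷ predsIn-dropHead (between ∘ there) ps

-- The predecessor of w is at least z > y, so it lies in xs: dropping y keeps the row above z ∷ zs.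
colsInc-fromPreds : ∀ {y xs z zs} → y < z → Linked _<_ (y ∷ xs) → Linked _<_ (z ∷ zs) →
                    PredsIn (z ∷ zs) (y ∷ xs) zs → ColsInc (y ∷ xs) (z ∷ zs)
colsInc-fromPreds {zs = []}     y<z _  _ _ = y<z , tt
colsInc-fromPreds {y} {xs} {z} {w ∷ zs} y<z ly (z<w ∷ lz) ps@((p , p∈ , p<w , max) ∷ _) =
  y<z , continue xs ly (∈-tail p∈ (<-≤-trans y<z (max (here refl) z<w))) ps
  where
  continue : ∀ xs → Linked _<_ (y ∷ xs) → p ∈ xs → PredsIn (z ∷ w ∷ zs) (y ∷ xs) (w ∷ zs) → ColsInc xs (w ∷ zs)
  continue (x ∷ xs) (_ ∷ lx) p∈xs (_ ∷ ps) =
    colsInc-fromPreds (≤-<-trans (head≤∈ lx p∈xs) p<w) lx lz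
      (predsIn-mono there id
        (predsIn-dropHead (λ j∈ → z , here refl , y<z , <-trans z<w (head<∈ lz j∈)) ps))

RichardsonFilling-tail : ∀ {r U} → RichardsonFilling (r ∷ U) → RichardsonFilling U
RichardsonFilling-tail {r} {U} rf = record
  { rows-nonempty      = All.tail (rows-nonempty rf)
  ; rows-increasing    = All.tail (rows-increasing rf)
  ; columns-increasing = proj₂ (colsIncAll-∷⁻ r U (columns-increasing rf))
  ; predecessors       = predRichardson-tail r U (predecessors rf)
  ; entries-unique     = Unique-++ʳ r (entries-unique rf)
  }

RichardsonFilling-[] : RichardsonFilling []
RichardsonFilling-[] = record
  { rows-nonempty = [] ; rows-increasing = [] ; columns-increasing = tt ; predecessors = tt ; entries-unique = [] }

-- The hole runs along the whole first row.
RichardsonFilling-dropFirst : ∀ {e x xs rs} → RichardsonFilling ((e ∷ x ∷ xs) ∷ rs) → All (x <_) (firstRow rs) →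
                              ColsInc (x ∷ xs) (firstRow rs) × RichardsonFilling ((x ∷ xs) ∷ rs)
RichardsonFilling-dropFirst {rs = []} rf _ = tt , record
  { rows-nonempty      = z<s ∷ []
  ; rows-increasing    = Linked.tail (All.head (rows-increasing rf)) ∷ []
  ; columns-increasing = tt
  ; predecessors       = tt
  ; entries-unique     = AllPairs.tail (entries-unique rf)
  }
RichardsonFilling-dropFirst {rs = [] ∷ _} rf _ with rows-nonempty rf
... | _ ∷ () ∷ _
RichardsonFilling-dropFirst {e} {x} {xs} {(h ∷ σ) ∷ rs} rf (x<h ∷ _)
  with rows-increasing rf | columns-increasing rf | predecessors rf
... | (e<x ∷ lx) ∷ lh ∷ ls | (e<h , _) , cs | ps , pss = cols , record
  { rows-nonempty      = z<s ∷ All.tail (rows-nonempty rf)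
  ; rows-increasing    = lx ∷ lh ∷ ls
  ; columns-increasing = cols , cs
  ; predecessors       = predsIn-mono there id
                           (predsIn-dropHead (λ j∈ → x , there (here refl) , e<x , <-≤-trans x<h (head≤∈ lh j∈)) ps) ,
                         pss
  ; entries-unique     = AllPairs.tail (entries-unique rf)
  }
  where
  cols : ColsInc (x ∷ xs) (h ∷ σ)
  cols = colsInc-fromPreds x<h lx lh
           (predsIn-mono (∈-++⁺ʳ (e ∷ x ∷ xs) ∘ ∈-++⁺ˡ) id
             (predsIn-dropHead (λ j∈ → h , ∈-++⁺ʳ (e ∷ x ∷ xs) (here refl) , e<h , head<∈ lh j∈) (All.tail ps)))

linked-∷-below : ∀ {h xs L} → (∀ {x xs′} → xs ≡ x ∷ xs′ → h ≤ x) → Unique (xs ++ h ∷ L) →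
                 Linked _<_ xs → Linked _<_ (h ∷ xs)
linked-∷-below {xs = []}         _  _         _ = [-]
linked-∷-below {h} {x ∷ xs} h≤ (x∉ ∷ _) l =
  ≤∧≢⇒< (h≤ refl) (λ h≡x → All.lookup x∉ (∈-++⁺ʳ xs (here refl)) (sym h≡x)) ∷ l

data SlideOutcome (e : ℕ) (xs : List ℕ) (rs : Tableau) : Tableau × (ℕ × ℕ) → Set where
  vanish : xs ≡ [] → rs ≡ [] → SlideOutcome e xs rs ([] , (0 , 0))
  along  : ∀ {x xs′} → xs ≡ x ∷ xs′ → SlideOutcome e xs rs ((x ∷ xs′) ∷ rs , (0 , length xs))
  down   : ∀ {h U i c} → e < h → SlideOutcome e xs rs ((h ∷ xs) ∷ U , (suc i , c))

descend-entries : ∀ {h xs σ} {rs U : Tableau} → concat U ↭ σ ++ concat rs →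
                  concat ((h ∷ xs) ∷ U) ↭ xs ++ concat ((h ∷ σ) ∷ rs)
descend-entries {h} {xs} {σ} {rs} U↭ = ↭-trans (prep h (++⁺ˡ xs U↭)) (↭-sym (shift h xs (σ ++ concat rs)))

descend-predsIn : ∀ {e xs h σ rs U} → RichardsonFilling ((e ∷ xs) ∷ (h ∷ σ) ∷ rs) → concat U ↭ σ ++ concat rs →
                  PredsIn (concat ((h ∷ xs) ∷ U)) (h ∷ xs) σ
descend-predsIn {e} {xs} {h} {σ} {rs} {U} rf U↭ with rows-increasing rf | columns-increasing rf | predecessors rf
... | _ ∷ lh ∷ _ | (e<h , _) , _ | ps , _ =
  predsIn-mono (there ∘ ∈-resp-↭ (descend-entries {h} {xs} {σ} {rs} {U} U↭)) there
    (predsIn-dropHead (λ j∈ → h , ∈-++⁺ʳ (e ∷ xs) (here refl) , e<h , head<∈ lh j∈) (All.tail ps))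

-- The new top row after the hole moved down from (e ∷ xs) into the next row h ∷ σ,
-- whose slide produced U.
descend-topRow : ∀ {e xs h σ rs U corner} → RichardsonFilling ((e ∷ xs) ∷ (h ∷ σ) ∷ rs) → Linked _<_ (h ∷ xs) →
                 RichardsonFilling U → concat U ↭ σ ++ concat rs → SlideOutcome h σ rs (U , corner) →
                 ColsInc (h ∷ xs) (firstRow U) × PredsIn (concat ((h ∷ xs) ∷ U)) (h ∷ xs) (firstRow U)
descend-topRow rf lh rfU U↭ (vanish refl refl) = tt , []
descend-topRow {xs = xs} {U = U} rf lh rfU U↭ (along {x′} {σ′} refl)
  with rows-increasing rf | columns-increasing rf
... | _ ∷ (h<x′ ∷ lσ) ∷ _ | (_ , cols) , _ = (h<x′ , colsInc-tail xs (x′ ∷ σ′) cols lσ) , descend-predsIn {U = U} rf U↭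
descend-topRow {xs = xs} {h = h} {U = U} rf lh rfU U↭ (down {h₂} h<h₂) =
  (h<h₂ , proj₂ (proj₁ (columns-increasing rf))) , newHead ∷ descend-predsIn {U = U} rf U↭
  where
  newHead : ∃[ p ] p ∈ h ∷ xs × MaxBelow (concat ((h ∷ xs) ∷ U)) h₂ p
  newHead = let p , p∈ , below = maxBelow-sorted lh h<h₂ in
            p , p∈ , maxBelow-++ below (RichardsonFilling-topLeft≤ rfU)

RichardsonFilling-descend : ∀ {e xs h σ rs U corner} → RichardsonFilling ((e ∷ xs) ∷ (h ∷ σ) ∷ rs) →
                            (∀ {x xs′} → xs ≡ x ∷ xs′ → h ≤ x) → RichardsonFilling U →
                            concat U ↭ σ ++ concat rs → SlideOutcome h σ rs (U , corner) →
                            RichardsonFilling ((h ∷ xs) ∷ U)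
RichardsonFilling-descend {e} {xs} {h} {σ} {rs} {U} rf h≤ rfU U↭ out = record
  { rows-nonempty      = z<s ∷ rows-nonempty rfU
  ; rows-increasing    = lh ∷ rows-increasing rfU
  ; columns-increasing = colsIncAll-∷⁺ (h ∷ xs) U (proj₁ top) (columns-increasing rfU)
  ; predecessors       = predRichardson-∷⁺ (h ∷ xs) U (proj₂ top) (predecessors rfU)
  ; entries-unique     = Unique-resp-↭ (↭-sym (descend-entries {h} {xs} {σ} {rs} {U} U↭)) (AllPairs.tail (entries-unique rf))
  }
  where
  lh : Linked _<_ (h ∷ xs)
  lh = linked-∷-below h≤ (AllPairs.tail (entries-unique rf)) (Linked.tail (All.head (rows-increasing rf)))
  top : ColsInc (h ∷ xs) (firstRow U) × PredsIn (concat ((h ∷ xs) ∷ U)) (h ∷ xs) (firstRow U)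
  top = descend-topRow rf lh rfU U↭ out

record SlideResult (e : ℕ) (xs : List ℕ) (rs : Tableau) : Set where
  constructor slideResult
  field
    tableau  : Tableau
    corner   : ℕ × ℕ
    computes : ∀ {k} → numBoxes ((e ∷ xs) ∷ rs) ≤ k → slide k ((e ∷ xs) ∷ rs) 0 0 ≡ (tableau , corner)
    filling  : RichardsonFilling tableau
    entries  : concat tableau ↭ xs ++ concat rs
    outcome  : SlideOutcome e xs rs (tableau , corner)

slideResult-descend : ∀ {e xs h σ rs} → RichardsonFilling ((e ∷ xs) ∷ (h ∷ σ) ∷ rs) →
                      (∀ {x xs′} → xs ≡ x ∷ xs′ → h ≤ x) → SlideResult h σ rs → SlideResult e xs ((h ∷ σ) ∷ rs)
slideResult-descend {e} {xs} {h} {σ} {rs} rf h≤ (slideResult U (i , c) computes rfU U↭ out) = slideResult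
  ((h ∷ xs) ∷ U) (suc i , c)
  (λ { {suc k} (s≤s le) → trans (slide-down k e xs h σ rs h≤)
                                (cong (underRow (h ∷ xs)) (computes (≤-trans (m≤n+m _ (length xs)) le))) })
  (RichardsonFilling-descend rf h≤ rfU U↭ out)
  (descend-entries {h} {xs} {σ} {rs} {U} U↭)
  (down (proj₁ (proj₁ (columns-increasing rf))))

slideFromTopLeft : ∀ {e xs rs} → RichardsonFilling ((e ∷ xs) ∷ rs) → SlideResult e xs rs
slideFromTopLeft {xs = []} {[]} rf =
  slideResult [] (0 , 0) (λ le → slide-along le tt) RichardsonFilling-[] ↭-refl (vanish refl refl)
slideFromTopLeft {xs = x ∷ xs} {[]} rf =
  slideResult ((x ∷ xs) ∷ []) (0 , suc (length xs)) (λ le → slide-along le tt)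
    (proj₂ (RichardsonFilling-dropFirst rf [])) ↭-refl (along refl)
slideFromTopLeft {rs = [] ∷ _} rf with rows-nonempty rf
... | _ ∷ () ∷ _
slideFromTopLeft {xs = []} {(h ∷ σ) ∷ rs} rf =
  slideResult-descend rf (λ ()) (slideFromTopLeft (RichardsonFilling-tail rf))
slideFromTopLeft {xs = x ∷ xs} {(h ∷ σ) ∷ rs} rf with x <? h
... | yes x<h =
  let cols , rf′ = RichardsonFilling-dropFirst rf (Linked⇒All <-trans x<h (All.head (All.tail (rows-increasing rf)))) in
  slideResult ((x ∷ xs) ∷ (h ∷ σ) ∷ rs) (0 , suc (length xs)) (λ le → slide-along le cols)
    rf′ ↭-refl (along refl)
... | no x≮h =
  slideResult-descend rf (λ { refl → ≮⇒≥ x≮h }) (slideFromTopLeft (RichardsonFilling-tail rf))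

oneTo : ℕ → List ℕ
oneTo m = map suc (upTo m)

RichardsonSYT : ℕ → Tableau → Set
RichardsonSYT m T = RichardsonFilling T × concat T ↭ oneTo m

oneTo-positive : ∀ m → All (0 <_) (oneTo m)
oneTo-positive m = Allₚ.map⁺ (All.tabulate (λ _ → z<s))

upTo-suc : ∀ k → upTo (suc k) ≡ 0 ∷ oneTo k
upTo-suc k = cong (0 ∷_) (sym (map-applyUpTo id suc k))

map-pred-oneTo : ∀ m → map pred (oneTo m) ≡ upTo m
map-pred-oneTo m = trans (sym (map-∘ (upTo m))) (map-id (upTo m))

length-↭oneTo : ∀ {L m} → L ↭ oneTo m → length L ≡ m
length-↭oneTo {m = m} L↭ = trans (↭-length L↭) (trans (length-map suc (upTo m)) (length-applyUpTo id m))

1∈-↭oneTo : ∀ {x L m} → x ∷ L ↭ oneTo m → 1 ∈ x ∷ L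
1∈-↭oneTo {m = zero}  L↭ with () ← length-↭oneTo L↭
1∈-↭oneTo {m = suc m} L↭ = ∈-resp-↭ (↭-sym L↭) (here refl)

pred-strictlyMonotoneOn : ∀ {L} → All (0 <_) L → StrictlyMonotoneOn L pred
pred-strictlyMonotoneOn pos x∈ _ x<y with All.lookup pos x∈
pred-strictlyMonotoneOn pos _  _ (s≤s x<y) | s≤s _ = x<y

numBoxes-mapEntries : ∀ f T → numBoxes (mapEntries f T) ≡ numBoxes T
numBoxes-mapEntries f []      = refl
numBoxes-mapEntries f (r ∷ T) = cong₂ _+_ (length-map f r) (numBoxes-mapEntries f T)

RichardsonSYT-positive : ∀ {m T} → RichardsonSYT m T → All (0 <_) (concat T)
RichardsonSYT-positive {m} (_ , T↭) = All-resp-↭ (↭-sym T↭) (oneTo-positive m)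

RichardsonSYT-topLeft : ∀ {m f fs rs} → RichardsonSYT m ((f ∷ fs) ∷ rs) → f ≡ 1
RichardsonSYT-topLeft rsyt@(rf , T↭) =
  ≤-antisym (RichardsonFilling-topLeft≤ rf (1∈-↭oneTo T↭)) (All.head (RichardsonSYT-positive rsyt))

-- How an evacuation step changes a Richardson tableau with first row 1 ∷ fs, paired with
-- the corner that receives the current largest value.
data EvacStepShape (k : ℕ) (fs : List ℕ) : Tableau × (ℕ × ℕ) → Set where
  vanish : k ≡ 0 → fs ≡ [] → EvacStepShape k fs ([] , (0 , 0))
  along  : ∀ {fs′ rs} → fs ≡ 2 ∷ fs′ → EvacStepShape k fs ((1 ∷ map pred fs′) ∷ rs , (0 , length fs))
  down   : ∀ {U i c} → EvacStepShape k fs ((1 ∷ map pred fs) ∷ U , (suc i , c))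

evacStepShape : ∀ {k} fs rs {res} → RichardsonSYT k (proj₁ res) →
                SlideOutcome 0 (map pred fs) (mapEntries pred rs) res → EvacStepShape k fs res
evacStepShape []       rs (_ , T↭) (vanish _ _) = vanish (sym (length-↭oneTo T↭)) refl
evacStepShape (a ∷ fs) rs rsyt     (along refl) with RichardsonSYT-topLeft rsyt
evacStepShape {k} (2 ∷ fs) rs rsyt (along refl) | refl =
  subst (λ c → EvacStepShape k (2 ∷ fs) ((1 ∷ map pred fs) ∷ mapEntries pred rs , (0 , c)))
        (cong suc (sym (length-map pred fs))) (along refl)
evacStepShape fs       rs rsyt     (down _) with RichardsonSYT-topLeft rsyt
... | refl = down

evacStep-RichardsonSYT : ∀ {k fs rs} → RichardsonSYT (suc k) ((1 ∷ fs) ∷ rs) →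
  ∃[ res ] evacStep ((1 ∷ fs) ∷ rs) ≡ res × RichardsonSYT k (proj₁ res) × EvacStepShape k fs res
evacStep-RichardsonSYT {k} {fs} {rs} rsyt@(rf , T↭) =
  (tableau , corner) ,
  computes (≤-reflexive (numBoxes-mapEntries pred ((1 ∷ fs) ∷ rs))) ,
  rsyt′ ,
  evacStepShape fs rs rsyt′ outcome
  where
  open SlideResult (slideFromTopLeft (RichardsonFilling-map (pred-strictlyMonotoneOn (RichardsonSYT-positive rsyt)) rf))
  decremented : 0 ∷ map pred fs ++ concat (mapEntries pred rs) ↭ 0 ∷ oneTo k
  decremented = subst₂ _↭_ (sym (concat-mapEntries ((1 ∷ fs) ∷ rs))) (trans (map-pred-oneTo (suc k)) (upTo-suc k))
                  (map⁺ pred T↭)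
  rsyt′ : RichardsonSYT k tableau
  rsyt′ = filling , ↭-trans entries (drop-∷ decremented)

-- The first row of the evacuation

placeInRow : List ℕ → ℕ × (ℕ × ℕ) → List ℕ
placeInRow r (v , (zero  , c)) = setRow r c v
placeInRow r (v , (suc i , c)) = r

firstRow-set : ∀ U i c v → firstRow (set U i c v) ≡ placeInRow (firstRow U) (v , (i , c))
firstRow-set []      zero    c v = refl
firstRow-set []      (suc i) c v = refl
firstRow-set (r ∷ U) zero    c v = refl
firstRow-set (r ∷ U) (suc i) c v = refl

numBoxes-set : ∀ U i c v → numBoxes (set U i c v) ≡ numBoxes U
numBoxes-set []      i       c v = refl
numBoxes-set (r ∷ U) zero    c v = cong (_+ numBoxes U) (length-setRow r c)
  where
  length-setRow : ∀ r c → length (setRow r c v) ≡ length r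
  length-setRow []      c       = refl
  length-setRow (x ∷ r) zero    = refl
  length-setRow (x ∷ r) (suc c) = cong suc (length-setRow r c)
numBoxes-set (r ∷ U) (suc i) c v = cong (length r +_) (numBoxes-set U i c v)

placeCell : Tableau → ℕ × (ℕ × ℕ) → Tableau
placeCell U (v , (i , c)) = set U i c v

firstRow-foldl : ∀ U L → firstRow (foldl placeCell U L) ≡ foldl placeInRow (firstRow U) L
firstRow-foldl U []                  = refl
firstRow-foldl U ((v , (i , c)) ∷ L) =
  trans (firstRow-foldl (set U i c v) L) (cong (λ r → foldl placeInRow r L) (firstRow-set U i c v))

numBoxes-foldl : ∀ U L → numBoxes (foldl placeCell U L) ≡ numBoxes U
numBoxes-foldl U []                  = refl
numBoxes-foldl U ((v , (i , c)) ∷ L) = trans (numBoxes-foldl (set U i c v) L) (numBoxes-set U i c v)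

evacSchedule : Tableau → List (ℕ × (ℕ × ℕ))
evacSchedule T = zip (map suc (downFrom (numBoxes T))) (evacCorners (numBoxes T) T)

numBoxes-evac : ∀ T → numBoxes (evac T) ≡ numBoxes T
numBoxes-evac T = trans (numBoxes-foldl (mapEntries (λ _ → 0) T) (evacSchedule T)) (numBoxes-mapEntries (λ _ → 0) T)

firstRow-evac : ∀ T → firstRow (evac T) ≡ foldl placeInRow (map (λ _ → 0) (firstRow T)) (evacSchedule T)
firstRow-evac []      = refl
firstRow-evac (r ∷ T) = firstRow-foldl (mapEntries (λ _ → 0) (r ∷ T)) (evacSchedule (r ∷ T))

-- The first row of evac T for a Richardson tableau T with n boxes and first row 1 ∷ fs.
evacFirstRow : ℕ → List ℕ → List ℕ
evacFirstRow n fs = 1 ∷ map (2 + n ∸_) (reverse fs)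

evacFirstRow-pred : ∀ k fs → All (0 <_) fs → evacFirstRow k (map pred fs) ≡ 1 ∷ map (3 + k ∸_) (reverse fs)
evacFirstRow-pred k fs pos = cong (1 ∷_) (begin
  map (2 + k ∸_) (reverse (map pred fs))
    ≡⟨ cong (map (2 + k ∸_)) (sym (reverse-map pred fs)) ⟩
  map (2 + k ∸_) (map pred (reverse fs))
    ≡⟨ sym (map-∘ (reverse fs)) ⟩
  map ((2 + k ∸_) ∘ pred) (reverse fs)
    ≡⟨ map-cong-local (All.map reflect-pred (All-resp-↭ (↭-sym (↭-reverse fs)) pos)) ⟩
  map (3 + k ∸_) (reverse fs) ∎)
  where
  open ≡-Reasoning
  reflect-pred : ∀ {a} → 0 < a → 2 + k ∸ pred a ≡ 3 + k ∸ a
  reflect-pred {suc a} _ = refl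

setRow-replicate : ∀ a (W : List ℕ) v → setRow (replicate (suc a) 0 ++ W) a v ≡ replicate a 0 ++ v ∷ W
setRow-replicate zero    W v = refl
setRow-replicate (suc a) W v = cong (0 ∷_) (setRow-replicate a W v)

EvacFoldFirstRow : ℕ → Set
EvacFoldFirstRow k = ∀ fs rs → RichardsonSYT k ((1 ∷ fs) ∷ rs) → ∀ W →
  foldl placeInRow (replicate (suc (length fs)) 0 ++ W) (zip (map suc (downFrom k)) (evacCorners k ((1 ∷ fs) ∷ rs)))
  ≡ evacFirstRow k fs ++ W

evacFold-step : ∀ {k fs W res} → EvacFoldFirstRow k → All (0 <_) fs → EvacStepShape k fs res → RichardsonSYT k (proj₁ res) →
  foldl placeInRow (placeInRow (replicate (suc (length fs)) 0 ++ W) (suc k , proj₂ res))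
        (zip (map suc (downFrom k)) (evacCorners k (proj₁ res)))
  ≡ evacFirstRow (suc k) fs ++ W
evacFold-step ih pos (vanish refl refl) _ = refl
evacFold-step {k} {W = W} ih (_ ∷ pos) (along {fs′} {rs′} refl) rsyt′ = begin
  foldl placeInRow (setRow (replicate (2 + length fs′) 0 ++ W) (suc (length fs′)) (suc k)) L
    ≡⟨ cong (λ r → foldl placeInRow r L) (setRow-replicate (suc (length fs′)) W (suc k)) ⟩
  foldl placeInRow (replicate (suc (length fs′)) 0 ++ suc k ∷ W) L
    ≡⟨ cong (λ n → foldl placeInRow (replicate (suc n) 0 ++ suc k ∷ W) L) (sym (length-map pred fs′)) ⟩
  foldl placeInRow (replicate (suc (length (map pred fs′))) 0 ++ suc k ∷ W) L
    ≡⟨ ih (map pred fs′) rs′ rsyt′ (suc k ∷ W) ⟩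
  evacFirstRow k (map pred fs′) ++ suc k ∷ W
    ≡⟨ cong (_++ suc k ∷ W) (evacFirstRow-pred k fs′ pos) ⟩
  1 ∷ (map (3 + k ∸_) (reverse fs′) ++ [ suc k ] ++ W)
    ≡⟨ cong (1 ∷_) (sym (++-assoc (map (3 + k ∸_) (reverse fs′)) [ suc k ] W)) ⟩
  1 ∷ ((map (3 + k ∸_) (reverse fs′) ++ [ suc k ]) ++ W)
    ≡⟨ cong (λ r → 1 ∷ (r ++ W)) (sym (map-++ (3 + k ∸_) (reverse fs′) [ 2 ])) ⟩
  1 ∷ (map (3 + k ∸_) (reverse fs′ ++ [ 2 ]) ++ W)
    ≡⟨ cong (λ r → 1 ∷ (map (3 + k ∸_) r ++ W)) (sym (unfold-reverse 2 fs′)) ⟩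
  evacFirstRow (suc k) (2 ∷ fs′) ++ W ∎
  where
  open ≡-Reasoning
  L : List (ℕ × (ℕ × ℕ))
  L = zip (map suc (downFrom k)) (evacCorners k ((1 ∷ map pred fs′) ∷ rs′))
evacFold-step {k} {fs} {W} ih pos (down {U}) rsyt′ = begin
  foldl placeInRow (replicate (suc (length fs)) 0 ++ W) L
    ≡⟨ cong (λ n → foldl placeInRow (replicate (suc n) 0 ++ W) L) (sym (length-map pred fs)) ⟩
  foldl placeInRow (replicate (suc (length (map pred fs))) 0 ++ W) L
    ≡⟨ ih (map pred fs) U rsyt′ W ⟩
  evacFirstRow k (map pred fs) ++ W
    ≡⟨ cong (_++ W) (evacFirstRow-pred k fs pos) ⟩
  evacFirstRow (suc k) fs ++ W ∎
  where
  open ≡-Reasoning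
  L : List (ℕ × (ℕ × ℕ))
  L = zip (map suc (downFrom k)) (evacCorners k ((1 ∷ map pred fs) ∷ U))

evacFold-firstRow : ∀ k → EvacFoldFirstRow k
evacFold-firstRow zero    fs rs (_ , T↭) W with () ← length-↭oneTo T↭
evacFold-firstRow (suc k) fs rs rsyt     W with evacStep-RichardsonSYT rsyt
... | res , step≡ , rsyt′ , shape =
  trans (cong (λ (U , corner) → foldl placeInRow (placeInRow (replicate (suc (length fs)) 0 ++ W) (suc k , corner))
                                      (zip (map suc (downFrom k)) (evacCorners k U))) step≡)
        (evacFold-step (evacFold-firstRow k) (Allₚ.++⁻ˡ fs (All.tail (RichardsonSYT-positive rsyt))) shape rsyt′)

map-const-0 : ∀ (r : List ℕ) → map (λ _ → 0) r ≡ replicate (length r) 0 ++ []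
map-const-0 []      = refl
map-const-0 (x ∷ r) = cong (0 ∷_) (map-const-0 r)

firstRow-evac-Richardson : ∀ {fs rs} → RichardsonSYT (numBoxes ((1 ∷ fs) ∷ rs)) ((1 ∷ fs) ∷ rs) →
                           firstRow (evac ((1 ∷ fs) ∷ rs)) ≡ evacFirstRow (numBoxes ((1 ∷ fs) ∷ rs)) fs
firstRow-evac-Richardson {fs} {rs} rsyt = begin
  firstRow (evac T)
    ≡⟨ firstRow-evac T ⟩
  foldl placeInRow (map (λ _ → 0) (1 ∷ fs)) (evacSchedule T)
    ≡⟨ cong (λ r → foldl placeInRow r (evacSchedule T)) (map-const-0 (1 ∷ fs)) ⟩
  foldl placeInRow (replicate (suc (length fs)) 0 ++ []) (evacSchedule T)
    ≡⟨ evacFold-firstRow (numBoxes T) fs rs rsyt [] ⟩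
  evacFirstRow (numBoxes T) fs ++ []
    ≡⟨ ++-identityʳ _ ⟩
  evacFirstRow (numBoxes T) fs ∎
  where
  open ≡-Reasoning
  T : Tableau
  T = (1 ∷ fs) ∷ rs

-- Reflecting the blocks

intervalsBetween : List ℕ → List (List ℕ)
intervalsBetween []           = []
intervalsBetween (a ∷ [])     = []
intervalsBetween (a ∷ b ∷ cs) = interval a b ∷ intervalsBetween (b ∷ cs)

blocksFrom-intervalsBetween : ∀ n A → blocksFrom n A ≡ intervalsBetween (A ++ [ suc n ])
blocksFrom-intervalsBetween n []           = refl
blocksFrom-intervalsBetween n (a ∷ [])     = refl
blocksFrom-intervalsBetween n (a ∷ b ∷ as) = cong (interval a b ∷_) (blocksFrom-intervalsBetween n (b ∷ as))

intervalsBetween-∷ʳ : ∀ X y z → intervalsBetween (X ++ y ∷ z ∷ []) ≡ intervalsBetween (X ++ [ y ]) ++ [ interval y z ]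
intervalsBetween-∷ʳ []           y z = refl
intervalsBetween-∷ʳ (x ∷ [])     y z = refl
intervalsBetween-∷ʳ (x ∷ x′ ∷ X) y z = cong (interval x x′ ∷_) (intervalsBetween-∷ʳ (x′ ∷ X) y z)

interval-empty : ∀ a → interval a a ≡ []
interval-empty a = cong (map (a +_) ∘ upTo) (n∸n≡0 a)

interval-∷ : ∀ {a b} → a < b → interval a b ≡ a ∷ interval (suc a) b
interval-∷ {a} {suc b} (s≤s a≤b) = begin
  map (a +_) (upTo (suc b ∸ a))               ≡⟨ cong (map (a +_) ∘ upTo) (+-∸-assoc 1 a≤b) ⟩
  map (a +_) (upTo (suc (b ∸ a)))             ≡⟨ cong (map (a +_)) (upTo-suc (b ∸ a)) ⟩
  map (a +_) (0 ∷ map suc (upTo (b ∸ a)))     ≡⟨ cong₂ _∷_ (+-identityʳ a) (sym (map-∘ (upTo (b ∸ a)))) ⟩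
  a ∷ map ((a +_) ∘ suc) (upTo (b ∸ a))       ≡⟨ cong (a ∷_) (map-cong (+-suc a) (upTo (b ∸ a))) ⟩
  a ∷ map (suc a +_) (upTo (b ∸ a))           ∎
  where open ≡-Reasoning

interval-∷ʳ : ∀ {a b} → a ≤ b → interval a (suc b) ≡ interval a b ++ [ b ]
interval-∷ʳ {a} {b} a≤b = begin
  map (a +_) (upTo (suc b ∸ a))                 ≡⟨ cong (map (a +_) ∘ upTo) (+-∸-assoc 1 a≤b) ⟩
  map (a +_) (upTo (suc (b ∸ a)))               ≡⟨ cong (map (a +_)) (sym (applyUpTo-∷ʳ id (b ∸ a))) ⟩
  map (a +_) (upTo (b ∸ a) ++ [ b ∸ a ])        ≡⟨ map-++ (a +_) (upTo (b ∸ a)) [ b ∸ a ] ⟩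
  interval a b ++ [ a + (b ∸ a) ]               ≡⟨ cong (λ c → interval a b ++ [ c ]) (m+[n∸m]≡n a≤b) ⟩
  interval a b ++ [ b ]                         ∎
  where open ≡-Reasoning

interval-reflect : ∀ N {a b} → a ≤ b → b ≤ N → map (N ∸_) (interval a b) ↭ interval (suc N ∸ b) (suc N ∸ a)
interval-reflect N {a} {b} a≤b b≤N with m≤n⇒m<n∨m≡n a≤b
... | inj₂ refl rewrite interval-empty a | interval-empty (suc N ∸ a) = ↭-refl
interval-reflect N {a} {suc b} _ b<N | inj₁ (s≤s a≤b) = begin
  map (N ∸_) (interval a (suc b))
    ≡⟨ cong (map (N ∸_)) (interval-∷ʳ a≤b) ⟩
  map (N ∸_) (interval a b ++ [ b ])
    ≡⟨ map-++ (N ∸_) (interval a b) [ b ] ⟩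
  map (N ∸_) (interval a b) ++ [ N ∸ b ]
    ↭⟨ ↭-sym (∷↭∷ʳ (N ∸ b) (map (N ∸_) (interval a b))) ⟩
  N ∸ b ∷ map (N ∸_) (interval a b)
    ↭⟨ prep (N ∸ b) (interval-reflect N a≤b (<⇒≤ b<N)) ⟩
  N ∸ b ∷ interval (suc N ∸ b) (suc N ∸ a)
    ≡⟨ cong (λ c → N ∸ b ∷ interval c (suc N ∸ a)) (+-∸-assoc 1 (<⇒≤ b<N)) ⟩
  N ∸ b ∷ interval (suc (N ∸ b)) (suc N ∸ a)
    ≡⟨ sym (interval-∷ N∸b<1+N∸a) ⟩
  interval (N ∸ b) (suc N ∸ a) ∎
  where
  open PermutationReasoning
  N∸b<1+N∸a : N ∸ b < suc N ∸ a
  N∸b<1+N∸a = <-≤-trans (s≤s (∸-monoʳ-≤ N a≤b)) (≤-reflexive (sym (+-∸-assoc 1 (≤-trans a≤b (<⇒≤ b<N)))))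

map-reverse-∷ : ∀ (f : ℕ → ℕ) c C → map f (reverse (c ∷ C)) ≡ map f (reverse C) ++ [ f c ]
map-reverse-∷ f c C = trans (cong (map f) (unfold-reverse c C)) (map-++ f (reverse C) [ c ])

intervalsBetween-reflect : ∀ N C → Linked _≤_ C → All (_≤ N) C →
  Pointwise _↭_ (intervalsBetween (map (suc N ∸_) (reverse C))) (reverse (map (map (N ∸_)) (intervalsBetween C)))
intervalsBetween-reflect N []            _            _                    = []
intervalsBetween-reflect N (c ∷ [])      _            _                    = []
intervalsBetween-reflect N (c₀ ∷ c₁ ∷ C) (c₀≤c₁ ∷ l) (_ ∷ c₁≤N ∷ C≤N) =
  subst₂ (Pointwise _↭_) (sym reflected)
    (sym (unfold-reverse (map (N ∸_) (interval c₀ c₁)) (map (map (N ∸_)) (intervalsBetween (c₁ ∷ C)))))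
    (Pointwise.++⁺ (intervalsBetween-reflect N (c₁ ∷ C) l (c₁≤N ∷ C≤N))
                   (↭-sym (interval-reflect N c₀≤c₁ c₁≤N) ∷ []))
  where
  g : ℕ → ℕ
  g = suc N ∸_
  reflected : intervalsBetween (map g (reverse (c₀ ∷ c₁ ∷ C)))
              ≡ intervalsBetween (map g (reverse (c₁ ∷ C))) ++ [ interval (g c₁) (g c₀) ]
  reflected = begin
    intervalsBetween (map g (reverse (c₀ ∷ c₁ ∷ C)))
      ≡⟨ cong intervalsBetween (map-reverse-∷ g c₀ (c₁ ∷ C)) ⟩
    intervalsBetween (map g (reverse (c₁ ∷ C)) ++ [ g c₀ ])
      ≡⟨ cong (λ X → intervalsBetween (X ++ [ g c₀ ])) (map-reverse-∷ g c₁ C) ⟩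
    intervalsBetween ((map g (reverse C) ++ [ g c₁ ]) ++ [ g c₀ ])
      ≡⟨ cong intervalsBetween (++-assoc (map g (reverse C)) [ g c₁ ] [ g c₀ ]) ⟩
    intervalsBetween (map g (reverse C) ++ g c₁ ∷ g c₀ ∷ [])
      ≡⟨ intervalsBetween-∷ʳ (map g (reverse C)) (g c₁) (g c₀) ⟩
    intervalsBetween (map g (reverse C) ++ [ g c₁ ]) ++ [ interval (g c₁) (g c₀) ]
      ≡⟨ cong (λ X → intervalsBetween X ++ [ interval (g c₁) (g c₀) ]) (sym (map-reverse-∷ g c₁ C)) ⟩
    intervalsBetween (map g (reverse (c₁ ∷ C))) ++ [ interval (g c₁) (g c₀) ] ∎
    where open ≡-Reasoning

evacFirstRow-∷ʳ : ∀ n fs → evacFirstRow n fs ++ [ suc n ] ≡ map (2 + n ∸_) (reverse ((1 ∷ fs) ++ [ suc n ]))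
evacFirstRow-∷ʳ n fs = sym (begin
  map g (reverse (1 ∷ fs ++ [ suc n ]))     ≡⟨ map-reverse-∷ g 1 (fs ++ [ suc n ]) ⟩
  map g (reverse (fs ++ [ suc n ])) ++ [ suc n ]  ≡⟨ cong (λ r → map g r ++ [ suc n ]) (reverse-++ fs [ suc n ]) ⟩
  (g (suc n) ∷ map g (reverse fs)) ++ [ suc n ]   ≡⟨ cong (λ a → (a ∷ map g (reverse fs)) ++ [ suc n ]) (m+n∸n≡m 1 n) ⟩
  evacFirstRow n fs ++ [ suc n ]                  ∎)
  where
  open ≡-Reasoning
  g : ℕ → ℕ
  g = 2 + n ∸_

linked-∷ʳ : ∀ {xs y} → Linked _<_ xs → All (_≤ y) xs → Linked _≤_ (xs ++ [ y ])
linked-∷ʳ []          []         = [-]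
linked-∷ʳ [-]         (x≤y ∷ []) = x≤y ∷ [-]
linked-∷ʳ (x<x′ ∷ l) (_ ∷ xs≤y)  = <⇒≤ x<x′ ∷ linked-∷ʳ l xs≤y

oneTo-≤ : ∀ m → All (_≤ m) (oneTo m)
oneTo-≤ m = Allₚ.map⁺ (All.tabulate ∈-upTo⁻)

Π-evac : ∀ {T} → RichardsonSYT (numBoxes T) T → Π (evac T) ≈ₛₚ map (map (suc (numBoxes T) ∸_)) (Π T)
Π-evac {[]} _ = BlockPermutation.↭-refl
Π-evac {[] ∷ _} (rf , _) with () ← All.head (rows-nonempty rf)
Π-evac {(f ∷ fs) ∷ rs} rsyt@(rf , T↭) with RichardsonSYT-topLeft rsyt
... | refl = begin
  blocksFrom (numBoxes (evac T)) (firstRow (evac T))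
    ≡⟨ cong₂ blocksFrom (numBoxes-evac T) (firstRow-evac-Richardson rsyt) ⟩
  blocksFrom n (evacFirstRow n fs)
    ≡⟨ blocksFrom-intervalsBetween n (evacFirstRow n fs) ⟩
  intervalsBetween (evacFirstRow n fs ++ [ suc n ])
    ≡⟨ cong intervalsBetween (evacFirstRow-∷ʳ n fs) ⟩
  intervalsBetween (map (2 + n ∸_) (reverse C))
    ≋⟨ intervalsBetween-reflect (suc n) C increasing bounded ⟩
  reverse (map (map (suc n ∸_)) (intervalsBetween C))
    ↭⟨ BlockPermutationProperties.↭-reverse _ ⟩
  map (map (suc n ∸_)) (intervalsBetween C)
    ≡⟨ cong (map (map (suc n ∸_))) (sym (blocksFrom-intervalsBetween n (1 ∷ fs))) ⟩
  map (map (suc n ∸_)) (Π T) ∎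
  where
  open BlockPermutation.PermutationReasoning
  T : Tableau
  T = (1 ∷ fs) ∷ rs
  n : ℕ
  n = numBoxes T
  C : List ℕ
  C = (1 ∷ fs) ++ [ suc n ]
  firstRow≤n : All (_≤ suc n) (1 ∷ fs)
  firstRow≤n = All.map m≤n⇒m≤1+n (Allₚ.++⁻ˡ (1 ∷ fs) (All-resp-↭ (↭-sym T↭) (oneTo-≤ n)))
  increasing : Linked _≤_ C
  increasing = linked-∷ʳ (All.head (rows-increasing rf)) firstRow≤n
  bounded : All (_≤ suc n) C
  bounded = Allₚ.++⁺ firstRow≤n (≤-refl ∷ [])

rank : List ℕ → ℕ → ℕ
rank L x = length (filter (_≤? x) L)

rank-∷-≤ : ∀ L {z x} → z ≤ x → rank (z ∷ L) x ≡ suc (rank L x)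
rank-∷-≤ L {x = x} z≤x = cong length (filter-accept (_≤? x) z≤x)

rank-∷-≰ : ∀ L {z x} → ¬ z ≤ x → rank (z ∷ L) x ≡ rank L x
rank-∷-≰ L {x = x} z≰x = cong length (filter-reject (_≤? x) z≰x)

rank-mono : ∀ L {x y} → x ≤ y → rank L x ≤ rank L y
rank-mono []      _ = z≤n
rank-mono (z ∷ L) {x} {y} x≤y with z ≤? x | z ≤? y
... | yes z≤x | yes z≤y rewrite rank-∷-≤ L z≤x | rank-∷-≤ L z≤y = s≤s (rank-mono L x≤y)
... | yes z≤x | no  z≰y = contradiction (≤-trans z≤x x≤y) z≰y
... | no  z≰x | yes z≤y rewrite rank-∷-≰ L z≰x | rank-∷-≤ L z≤y = m≤n⇒m≤1+n (rank-mono L x≤y)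
... | no  z≰x | no  z≰y rewrite rank-∷-≰ L z≰x | rank-∷-≰ L z≰y = rank-mono L x≤y

rank-strict : ∀ L {x y} → y ∈ L → x < y → rank L x < rank L y
rank-strict (z ∷ L) {x} {y} y∈ x<y with z ≤? x | z ≤? y
... | yes z≤x | yes z≤y rewrite rank-∷-≤ L z≤x | rank-∷-≤ L z≤y =
  s≤s (rank-strict L (∈-tail y∈ (≤-<-trans z≤x x<y)) x<y)
... | yes z≤x | no  z≰y = contradiction (≤-trans z≤x (<⇒≤ x<y)) z≰y
... | no  z≰x | yes z≤y rewrite rank-∷-≰ L z≰x | rank-∷-≤ L z≤y = s≤s (rank-mono L (<⇒≤ x<y))
... | no  z≰x | no  z≰y rewrite rank-∷-≰ L z≰x | rank-∷-≰ L z≰y with y∈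
...   | here refl = contradiction ≤-refl z≰y
...   | there y∈L = rank-strict L y∈L x<y

rank-strictlyMonotoneOn : ∀ L → StrictlyMonotoneOn L (rank L)
rank-strictlyMonotoneOn L _ y∈ = rank-strict L y∈

rank-positive : ∀ {L x} → x ∈ L → 0 < rank L x
rank-positive {z ∷ L} {x} x∈ with z ≤? x
... | yes z≤x rewrite rank-∷-≤ L z≤x = z<s
... | no  z≰x rewrite rank-∷-≰ L z≰x with x∈
...   | here refl = contradiction ≤-refl z≰x
...   | there x∈L = rank-positive x∈L

predsIn-fromPredecessors : ∀ {L r s} → All (0 <_) s → All (λ j → j ∸ 1 ∈ r) s → PredsIn L r s
predsIn-fromPredecessors []                []         = []
predsIn-fromPredecessors (s≤s _ ∷ pos) (j-1∈r ∷ cond) =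
  (_ , j-1∈r , ≤-refl , λ { _ (s≤s y≤j-1) → y≤j-1 }) ∷ predsIn-fromPredecessors pos cond

richardson⇒predRichardson : ∀ {T} → Richardson T → All (0 <_) (concat T) → PredRichardson T
richardson⇒predRichardson rich-empty                   _   = tt
richardson⇒predRichardson (rich-step r []      _ _)    _   = tt
-- crop (r ∷ s ∷ U) is, by the definition of standardize, mapEntries (rank (concat (s ∷ U))) (s ∷ U).
richardson⇒predRichardson (rich-step r (s ∷ U) cond rich) pos =
  predsIn-fromPredecessors (Allₚ.++⁻ˡ s (Allₚ.++⁻ʳ r pos)) cond ,
  predRichardson-map⁻ (rank-strictlyMonotoneOn (concat (s ∷ U)))
    (richardson⇒predRichardson rich
      (subst (All (0 <_)) (sym (concat-mapEntries (s ∷ U))) (Allₚ.map⁺ (All.tabulate rank-positive))))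

RichardsonSYT-fromSYT : ∀ {λ′ T} → IsSYT λ′ T → Richardson T → RichardsonSYT (numBoxes T) T
RichardsonSYT-fromSYT {T = T} ((parts-positive , _) , shape≡ , rows , cols , T↭) rich = record
  { rows-nonempty      = Allₚ.map⁻ (subst (All (0 <_)) (sym shape≡) parts-positive)
  ; rows-increasing    = rows
  ; columns-increasing = cols
  ; predecessors       = richardson⇒predRichardson rich (All-resp-↭ (↭-sym T↭′) (oneTo-positive (numBoxes T)))
  ; entries-unique     = Unique-resp-↭ (↭-sym T↭′) (Unique.map⁺ suc-injective (Unique.upTo⁺ (numBoxes T)))
  } , T↭′
  where
  T↭′ : concat T ↭ oneTo (numBoxes T)
  T↭′ = subst (λ m → concat T ↭ oneTo m) (sym (cong size shape≡)) T↭

corollary5p10 : (λ′ : List ℕ) (T : Tableau) → IsSYT λ′ T → Richardson T →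
    Π (evac T) ≈ₛₚ map (map (λ i → suc (size λ′) ∸ i)) (Π T)
corollary5p10 λ′ T syt@(_ , shape≡ , _) rich =
  subst (λ m → Π (evac T) ≈ₛₚ map (map (suc m ∸_)) (Π T)) (cong size shape≡) (Π-evac (RichardsonSYT-fromSYT syt rich))
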